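{- Let $m$ be a positive integer, $n>1$, and let $H$ be an $r$-regular graph of order $n$ admitting a local distance antimagic labeling. Then $\chi_{ld}(K_m[H])\le m\cdot\chi_{ld}(H)$.
   Context: For a graph $G=(V,E)$ of order $N$ and a bijection $f\colon V\to\{1,\dots,N\}$, the weight of a vertex $u$ is $w(u)=\sum_{x\in N(u)}f(x)$, where $N(u)$ is the open neighborhood of $u$. The bijection $f$ is a local distance antimagic labeling if $w(u)\neq w(v)$ for every edge $uv$. $\chi_{ld}(G)$ is the minimum number of distinct weights over all local distance antimagic labelings of $G$. $K_m$ is the complete graph on $m$ vertices. The lexicographic product $G[H]$ has vertex set $V(G)\times V(H)$, with $(g,h)$ adjacent to $(g',h')$ iff $gg'\in E(G)$, or $g=g'$ and $hh'\in E(H)$. -}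

module Defs where

open import Data.Nat using (ℕ; zero; suc; _+_; _*_; _≤_)
open import Data.Nat.Properties using (_≟_)
open import Data.Bool using (Bool; true; false; if_then_else_; _∨_; _∧_; not)
open import Data.Fin using (Fin; toℕ; remQuot)
import Data.Fin as F
open import Data.List using (List; map; length; deduplicate; filter)
open import Data.Nat.ListAction using (sum)
open import Data.List.Base using (allFin)
open import Data.Product using (_×_; _,_; Σ; proj₁; proj₂)
open import Relation.Nullary.Decidable using (⌊_⌋)
open import Relation.Binary.PropositionalEquality using (_≡_; _≢_)
open import Function.Definitions using (Bijective)

Adj : ℕ → Set
Adj N = Fin N → Fin N → Bool

IsSimpleGraph : {N : ℕ} → Adj N → Set
IsSimpleGraph {N} G = (∀ u v → G u v ≡ G v u) × (∀ u → G u u ≡ false)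

degree : {N : ℕ} → Adj N → Fin N → ℕ
degree {N} G u = length (filter (λ x → Data.Bool._≟_ (G u x) true) (allFin N))

IsRegular : {N : ℕ} → Adj N → ℕ → Set
IsRegular {N} G r = ∀ u → degree G u ≡ r

-- a labeling f : V → {1..N} is a bijection Fin N → Fin N; vertex x gets label toℕ (f x) + 1
Labeling : ℕ → Set
Labeling N = Σ (Fin N → Fin N) (Bijective _≡_ _≡_)

label : {N : ℕ} → Labeling N → Fin N → ℕ
label (f , _) x = suc (toℕ (f x))

weight : {N : ℕ} → Adj N → Labeling N → Fin N → ℕ
weight {N} G f u = sum (map (λ x → if G u x then label f x else 0) (allFin N))

IsLDAntimagic : {N : ℕ} → Adj N → Labeling N → Set
IsLDAntimagic {N} G f = ∀ u v → G u v ≡ true → weight G f u ≢ weight G f v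

numWeights : {N : ℕ} → Adj N → Labeling N → ℕ
numWeights {N} G f = length (deduplicate _≟_ (map (weight G f) (allFin N)))

IsChiLD : {N : ℕ} → Adj N → ℕ → Set
IsChiLD {N} G c =
  (Σ (Labeling N) λ f → IsLDAntimagic G f × numWeights G f ≡ c)
  × (∀ (f : Labeling N) → IsLDAntimagic G f → c ≤ numWeights G f)

ChiLD≤ : {N : ℕ} → Adj N → ℕ → Set
ChiLD≤ {N} G k = Σ (Labeling N) λ f → IsLDAntimagic G f × numWeights G f ≤ k

complete : (m : ℕ) → Adj m
complete m i j = not ⌊ i F.≟ j ⌋

lex : {m n : ℕ} → Adj m → Adj n → Adj (m * n)
lex {m} {n} G H a b with remQuot {m} n a | remQuot {m} n b
... | (g , h) | (g' , h') = G g g' ∨ (⌊ g F.≟ g' ⌋ ∧ H h h')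

-- Label the copy {g} × H of K_m[H] by h ↦ n·g + f(h). The vertex (g, h) sees every vertex of
-- the other copies and the H-neighbours of h in its own copy, so for r-regular H its weight is
-- (sum of all labels) + w(h) − ((n − r)·n·g + Σ f). Within a copy, weights therefore compare as
-- in H. Across copies g < g′ they cannot coincide: the shift is at least n(n − r), whereas two
-- weights of H differ by at most (n − 1)(n − r) < n(n − r) (as H is loopless, n − r ≥ 1), since
-- N(v) ∖ N(u) consists of at most n − r non-neighbours of u with labels ≤ n and is balanced by
-- as many labels ≥ 1 in N(u) ∖ N(v).
-- Finally each copy carries at most χ_ld(H) distinct weights.
{-# OPTIONS --safe #-}
module Submission where

open import Defs
open import Data.Nat using (ℕ; zero; suc; _+_; _*_; _∸_; _≤_; _<_; z≤n; s≤s)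
open import Data.Nat.Properties
open import Data.Nat.Tactic.RingSolver using (solve-∀)
open import Data.Bool using (Bool; true; false; if_then_else_; _∨_; _∧_; not)
import Data.Bool as Bool
open import Data.Fin using (Fin; toℕ; combine; remQuot; _↑ˡ_; _↑ʳ_; punchIn)
import Data.Fin as Fin
open import Data.Fin.Properties
  using (*↔×; remQuot-combine; combine-remQuot; toℕ-combine; toℕ<n; punchInᵢ≢i)
  renaming (<-cmp to <-cmpᶠ)
open import Data.List
  using (List; []; _∷_; map; length; filter; tabulate; allFin; deduplicate; cartesianProductWith)
open import Data.List.Properties using (map-tabulate; length-++; length-map; length-tabulate; filter-notAll)
import Data.Nat.ListAction as List
open import Data.List.Membership.Propositional using (_∈_)
open import Data.List.Membership.Propositional.Properties
  using (∈-map⁺; ∈-map⁻; ∈-allFin; ∈-filter⁺; ∈-deduplicate⁺; ∈-deduplicate⁻; ∈-cartesianProductWith⁺)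
open import Data.List.Relation.Binary.Subset.Propositional using (_⊆_)
open import Data.List.Relation.Unary.Any using (here; there)
import Data.List.Relation.Unary.Any as Any
import Data.List.Relation.Unary.All as All
import Data.List.Relation.Unary.AllPairs as AllPairs
open import Data.List.Relation.Unary.Unique.Propositional using (Unique)
open import Data.List.Relation.Unary.Unique.DecPropositional.Properties using (deduplicate-!)
open import Data.Product using (Σ; _×_; _,_; proj₁; proj₂; uncurry; map₂)
open import Data.Product.Function.NonDependent.Propositional using (_×-↔_)
open import Function using (_∘_; id; Bijection)
open import Function.Bundles using (_⤖_; mk⤖)
open import Function.Properties.Bijection using (⤖⇒↔)
open import Function.Properties.Inverse using (↔-refl; ↔-sym; ↔-trans; ↔⇒⤖)
open import Relation.Binary using (tri<; tri≈; tri>)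
open import Relation.Binary.Definitions using (DecidableEquality)
open import Relation.Binary.PropositionalEquality
open import Relation.Nullary using (¬_; ¬?)
open import Relation.Nullary.Decidable using (⌊_⌋; isYes≗does; dec-true; dec-false)
open import Algebra.Properties.CommutativeSemigroup +-commutativeSemigroup
  using (x∙yz≈y∙xz; xy∙z≈xz∙y; xy∙z≈x∙zy; xy∙z≈zy∙x)
open import Algebra.Properties.Semiring.Sum +-*-semiring
  using (sum; sum-syntax; sum-cong-≗; ∑-distrib-+; sum-remove; *-distribˡ-sum)

sum-tabulate : ∀ {N} (φ : Fin N → ℕ) → List.sum (tabulate φ) ≡ ∑[ i < N ] φ i
sum-tabulate {zero}  φ = refl
sum-tabulate {suc N} φ = cong (φ Fin.zero +_) (sum-tabulate (φ ∘ Fin.suc))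

count-tabulate : ∀ {A : Set} {N} (b : A → Bool) (g : Fin N → A) →
  length (filter (λ x → b x Bool.≟ true) (tabulate g)) ≡ ∑[ i < N ] (if b (g i) then 1 else 0)
count-tabulate {N = zero}  b g = refl
count-tabulate {N = suc N} b g with b (g Fin.zero)
... | true  = cong suc (count-tabulate b (g ∘ Fin.suc))
... | false = count-tabulate b (g ∘ Fin.suc)

∑-const : ∀ N c → ∑[ i < N ] c ≡ N * c
∑-const zero    c = refl
∑-const (suc N) c = cong (c +_) (∑-const N c)

∑-mono-≤ : ∀ {N} {φ ψ : Fin N → ℕ} → (∀ i → φ i ≤ ψ i) → ∑[ i < N ] φ i ≤ ∑[ i < N ] ψ i
∑-mono-≤ {zero}  φ≤ψ = z≤n
∑-mono-≤ {suc N} φ≤ψ = +-mono-≤ (φ≤ψ Fin.zero) (∑-mono-≤ (φ≤ψ ∘ Fin.suc))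

term≤∑ : ∀ {N} (φ : Fin N → ℕ) i → φ i ≤ ∑[ j < N ] φ j
term≤∑ {suc N} φ i = ≤-trans (m≤m+n (φ i) _) (≤-reflexive (sym (sum-remove {i = i} φ)))

∑-split : ∀ N K (ψ : Fin (N + K) → ℕ) →
  ∑[ a < N + K ] ψ a ≡ ∑[ i < N ] ψ (i ↑ˡ K) + ∑[ j < K ] ψ (N ↑ʳ j)
∑-split zero    K ψ = refl
∑-split (suc N) K ψ =
  trans (cong (ψ Fin.zero +_) (∑-split N K (ψ ∘ Fin.suc))) (sym (+-assoc (ψ Fin.zero) _ _))

∑-combine : ∀ M N (ψ : Fin (M * N) → ℕ) →
  ∑[ a < M * N ] ψ a ≡ ∑[ g < M ] ∑[ h < N ] ψ (combine g h)
∑-combine zero    N ψ = refl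
∑-combine (suc M) N ψ =
  trans (∑-split N (M * N) ψ) (cong (∑[ h < N ] ψ (h ↑ˡ (M * N)) +_) (∑-combine M N (ψ ∘ (N ↑ʳ_))))

∑-differAt : ∀ {N} (s t : Fin N → ℕ) i → (∀ j → j ≢ i → s j ≡ t j) →
  ∑[ j < N ] s j + t i ≡ ∑[ j < N ] t j + s i
∑-differAt {suc N} s t i s≡t = begin
  ∑[ j < suc N ] s j + t i          ≡⟨ cong (_+ t i) (sum-remove {i = i} s) ⟩
  s i + ∑s′ + t i                   ≡⟨ cong (λ x → s i + x + t i) ∑s′≡∑t′ ⟩
  s i + ∑t′ + t i                   ≡⟨ xy∙z≈zy∙x (s i) ∑t′ (t i) ⟩
  t i + ∑t′ + s i                   ≡⟨ cong (_+ s i) (sum-remove {i = i} t) ⟨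
  ∑[ j < suc N ] t j + s i          ∎
  where
  open ≡-Reasoning
  ∑s′ ∑t′ : ℕ
  ∑s′ = ∑[ j < N ] s (punchIn i j)
  ∑t′ = ∑[ j < N ] t (punchIn i j)
  ∑s′≡∑t′ : ∑s′ ≡ ∑t′
  ∑s′≡∑t′ = sum-cong-≗ (λ j → s≡t (punchIn i j) (punchInᵢ≢i i j))

Unique-⊆⇒length≤ : ∀ {A : Set} → DecidableEquality A → {xs ys : List A} →
  Unique xs → xs ⊆ ys → length xs ≤ length ys
Unique-⊆⇒length≤ _≟_ {[]}     _              _     = z≤n
Unique-⊆⇒length≤ _≟_ {x ∷ xs} {ys} (x∉xs AllPairs.∷ xs!) xs⊆ys =
  ≤-trans (s≤s (Unique-⊆⇒length≤ _≟_ xs! xs⊆ys-x)) (filter-notAll (¬? ∘ (x ≟_)) ys x∈ys)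
  where
  x∈ys : Any.Any (λ y → ¬ ¬ x ≡ y) ys
  x∈ys = Any.map (λ x≡y x≢y → x≢y x≡y) (xs⊆ys (here refl))
  xs⊆ys-x : xs ⊆ filter (¬? ∘ (x ≟_)) ys
  xs⊆ys-x y∈xs = ∈-filter⁺ (¬? ∘ (x ≟_)) (xs⊆ys (there y∈xs)) (All.lookup x∉xs y∈xs)

length-cartesianProductWith : ∀ {A B C : Set} (f : A → B → C) xs ys →
  length (cartesianProductWith f xs ys) ≡ length xs * length ys
length-cartesianProductWith f []       ys = refl
length-cartesianProductWith f (x ∷ xs) ys =
  trans (length-++ (map (f x) ys))
        (cong₂ _+_ (length-map (f x) ys) (length-cartesianProductWith f xs ys))

distinctValues : ∀ {N} → (Fin N → ℕ) → ℕ
distinctValues {N} φ = length (deduplicate _≟_ (map φ (allFin N)))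

distinctValues-combine≤ : ∀ {m n} {φ : Fin (m * n) → ℕ} {ψ : Fin n → ℕ} (Φ : Fin m → ℕ → ℕ) →
  (∀ g h → φ (combine g h) ≡ Φ g (ψ h)) → distinctValues φ ≤ m * distinctValues ψ
distinctValues-combine≤ {m} {n} {φ} {ψ} Φ φ≡Φψ = begin
  distinctValues φ                                     ≤⟨ Unique-⊆⇒length≤ _≟_ (deduplicate-! _≟_ _) φ-values⊆ ⟩
  length (cartesianProductWith Φ (allFin m) ψ-values)  ≡⟨ length-cartesianProductWith Φ (allFin m) ψ-values ⟩
  length (allFin m) * distinctValues ψ                 ≡⟨ cong (_* distinctValues ψ) (length-tabulate {n = m} id) ⟩
  m * distinctValues ψ                                 ∎
  where
  open ≤-Reasoning
  ψ-values : List ℕ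
  ψ-values = deduplicate _≟_ (map ψ (allFin n))
  φ-values⊆ : deduplicate _≟_ (map φ (allFin (m * n))) ⊆ cartesianProductWith Φ (allFin m) ψ-values
  φ-values⊆ v∈ with ∈-map⁻ φ (∈-deduplicate⁻ _≟_ _ v∈)
  ... | a , _ , refl = subst (_∈ _) (trans (sym (φ≡Φψ g h)) (cong φ (combine-remQuot {m} n a)))
    (∈-cartesianProductWith⁺ Φ (∈-allFin g) (∈-deduplicate⁺ _≟_ (∈-map⁺ ψ (∈-allFin h))))
    where
    g : Fin m
    g = proj₁ (remQuot {m} n a)
    h : Fin n
    h = proj₂ (remQuot {m} n a)

weight≡∑ : ∀ {N} (G : Adj N) (f : Labeling N) u →
  weight G f u ≡ ∑[ x < N ] (if G u x then label f x else 0)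
weight≡∑ {N} G f u = trans (cong List.sum (map-tabulate {n = N} id _)) (sum-tabulate {N} _)

degree≡∑ : ∀ {N} (G : Adj N) u → degree G u ≡ ∑[ x < N ] (if G u x then 1 else 0)
degree≡∑ G u = count-tabulate (G u) id

codegree : ∀ {N} → Adj N → Fin N → ℕ
codegree {N} G u = ∑[ x < N ] (if G u x then 0 else 1)

degree+codegree : ∀ {N} (G : Adj N) u → degree G u + codegree G u ≡ N
degree+codegree {N} G u = begin
  degree G u + codegree G u
    ≡⟨ cong (_+ codegree G u) (degree≡∑ G u) ⟩
  ∑[ x < N ] (if G u x then 1 else 0) + codegree G u
    ≡⟨ ∑-distrib-+ (λ x → if G u x then 1 else 0) _ ⟨
  ∑[ x < N ] ((if G u x then 1 else 0) + (if G u x then 0 else 1))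
    ≡⟨ sum-cong-≗ (λ x → one (G u x)) ⟩
  ∑[ x < N ] 1
    ≡⟨ ∑-const N 1 ⟩
  N * 1
    ≡⟨ *-identityʳ N ⟩
  N ∎
  where
  open ≡-Reasoning
  one : ∀ b → (if b then 1 else 0) + (if b then 0 else 1) ≡ 1
  one true  = refl
  one false = refl

codegree-regular : ∀ {N} (G : Adj N) {r} → IsRegular G r → ∀ u → codegree G u ≡ N ∸ r
codegree-regular {N} G {r} regular u = begin
  codegree G u                   ≡⟨ m+n∸m≡n r _ ⟨
  r + codegree G u ∸ r           ≡⟨ cong (λ d → d + codegree G u ∸ r) (regular u) ⟨
  degree G u + codegree G u ∸ r  ≡⟨ cong (_∸ r) (degree+codegree G u) ⟩
  N ∸ r                          ∎
  where open ≡-Reasoning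

codegree-positive : ∀ {N} (G : Adj N) u → G u u ≡ false → 1 ≤ codegree G u
codegree-positive G u Guu≡false =
  subst (λ b → (if b then 0 else 1) ≤ codegree G u) Guu≡false (term≤∑ _ u)

weight-shift : ∀ {N} (G : Adj N) (f : Labeling N) c u →
  ∑[ x < N ] (if G u x then c + label f x else 0) ≡ c * degree G u + weight G f u
weight-shift {N} G f c u = begin
  ∑[ x < N ] (if G u x then c + label f x else 0)
    ≡⟨ sum-cong-≗ (λ x → split (G u x) (label f x)) ⟩
  ∑[ x < N ] (c * (if G u x then 1 else 0) + (if G u x then label f x else 0))
    ≡⟨ ∑-distrib-+ (λ x → c * (if G u x then 1 else 0)) _ ⟩
  ∑[ x < N ] (c * (if G u x then 1 else 0)) + ∑[ x < N ] (if G u x then label f x else 0)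
    ≡⟨ cong₂ _+_ (*-distribˡ-sum c (λ x → if G u x then 1 else 0)) (weight≡∑ G f u) ⟨
  c * ∑[ x < N ] (if G u x then 1 else 0) + weight G f u
    ≡⟨ cong (λ d → c * d + weight G f u) (degree≡∑ G u) ⟨
  c * degree G u + weight G f u
    ∎
  where
  open ≡-Reasoning
  split : ∀ b ℓ → (if b then c + ℓ else 0) ≡ c * (if b then 1 else 0) + (if b then ℓ else 0)
  split true  ℓ = cong (_+ ℓ) (sym (*-identityʳ c))
  split false ℓ = sym (trans (+-identityʳ _) (*-zeroʳ c))

weight-gap-pointwise : ∀ (a b : Bool) {ℓ N} → 1 ≤ ℓ → ℓ ≤ N →
  (if b then ℓ else 0) + ((if a then 1 else 0) + (if a then 0 else 1))
    ≤ (if a then ℓ else 0) + N * (if a then 0 else 1) + (if b then 1 else 0)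
weight-gap-pointwise true  true  {ℓ} {N} _   _   rewrite *-zeroʳ N | +-identityʳ ℓ = ≤-refl
weight-gap-pointwise true  false {ℓ} {N} 1≤ℓ _   rewrite *-zeroʳ N | +-identityʳ ℓ | +-identityʳ ℓ = 1≤ℓ
weight-gap-pointwise false true  {ℓ} {N} _   ℓ≤N rewrite *-identityʳ N = +-monoˡ-≤ 1 ℓ≤N
weight-gap-pointwise false false {ℓ} {N} 1≤ℓ ℓ≤N rewrite *-identityʳ N | +-identityʳ N = ≤-trans 1≤ℓ ℓ≤N

weight-gap : ∀ {N} (G : Adj N) (f : Labeling N) {u v} → degree G u ≡ degree G v →
  weight G f v + codegree G u ≤ weight G f u + N * codegree G u
weight-gap {N} G f {u} {v} deg-u≡deg-v = +-cancelˡ-≤ (degree G u) _ _ (begin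
  degree G u + (weight G f v + codegree G u)
    ≡⟨ x∙yz≈y∙xz (degree G u) (weight G f v) (codegree G u) ⟩
  weight G f v + (degree G u + codegree G u)
    ≡⟨ cong₂ _+_ (weight≡∑ G f v) (cong (_+ codegree G u) (degree≡∑ G u)) ⟩
  sum (nbrLabel v) + (sum (isNbr u) + sum (isNonNbr u))
    ≡⟨ ∑-distrib-+₃ (nbrLabel v) (isNbr u) (isNonNbr u) ⟨
  sum (λ x → nbrLabel v x + (isNbr u x + isNonNbr u x))
    ≤⟨ ∑-mono-≤ pointwise ⟩
  sum (λ x → nbrLabel u x + N * isNonNbr u x + isNbr v x)
    ≡⟨ ∑-distrib-+ _ (isNbr v) ⟩
  sum (λ x → nbrLabel u x + N * isNonNbr u x) + sum (isNbr v)
    ≡⟨ cong (_+ sum (isNbr v)) (∑-distrib-+ (nbrLabel u) _) ⟩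
  sum (nbrLabel u) + sum (λ x → N * isNonNbr u x) + sum (isNbr v)
    ≡⟨ cong₂ (λ a b → sum (nbrLabel u) + a + b) (*-distribˡ-sum N (isNonNbr u)) (degree≡∑ G v) ⟨
  sum (nbrLabel u) + N * codegree G u + degree G v
    ≡⟨ cong₂ (λ a b → a + N * codegree G u + b) (weight≡∑ G f u) deg-u≡deg-v ⟨
  weight G f u + N * codegree G u + degree G u
    ≡⟨ +-comm _ (degree G u) ⟩
  degree G u + (weight G f u + N * codegree G u)
    ∎)
  where
  open ≤-Reasoning
  nbrLabel isNbr isNonNbr : Fin N → Fin N → ℕ
  nbrLabel y x = if G y x then label f x else 0
  isNbr    y x = if G y x then 1 else 0
  isNonNbr y x = if G y x then 0 else 1
  pointwise : ∀ x → nbrLabel v x + (isNbr u x + isNonNbr u x) ≤ nbrLabel u x + N * isNonNbr u x + isNbr v x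
  pointwise x = weight-gap-pointwise (G u x) (G v x) (s≤s z≤n) (toℕ<n (proj₁ f x))
  ∑-distrib-+₃ : ∀ (φ ψ χ : Fin N → ℕ) → sum (λ x → φ x + (ψ x + χ x)) ≡ sum φ + (sum ψ + sum χ)
  ∑-distrib-+₃ φ ψ χ = trans (∑-distrib-+ φ _) (cong (sum φ +_) (∑-distrib-+ ψ χ))

lex-combine : ∀ {m n} (G : Adj m) (H : Adj n) g h g′ h′ →
  lex G H (combine g h) (combine g′ h′) ≡ G g g′ ∨ (⌊ g Fin.≟ g′ ⌋ ∧ H h h′)
lex-combine {m} {n} G H g h g′ h′ = cong₂ lexPairs (remQuot-combine g h) (remQuot-combine g′ h′)
  where
  lexPairs : Fin m × Fin n → Fin m × Fin n → Bool
  lexPairs (a , b) (a′ , b′) = G a a′ ∨ (⌊ a Fin.≟ a′ ⌋ ∧ H b b′)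

complete-lex-≢ : ∀ {m n} (H : Adj n) {g g′ : Fin m} h h′ → g ≢ g′ →
  lex (complete m) H (combine g h) (combine g′ h′) ≡ true
complete-lex-≢ {m} H {g} {g′} h h′ g≢g′ = trans (lex-combine (complete m) H g h g′ h′)
  (cong (λ b → not b ∨ (b ∧ H h h′)) (trans (isYes≗does (g Fin.≟ g′)) (dec-false (g Fin.≟ g′) g≢g′)))

complete-lex-≡ : ∀ {m n} (H : Adj n) (g : Fin m) h h′ →
  lex (complete m) H (combine g h) (combine g h′) ≡ H h h′
complete-lex-≡ {m} H g h h′ = trans (lex-combine (complete m) H g h g h′)
  (cong (λ b → not b ∨ (b ∧ H h h′)) (trans (isYes≗does (g Fin.≟ g)) (dec-true (g Fin.≟ g) refl)))

weight-complete-lex : ∀ {m n} (H : Adj n) (F : Labeling (m * n)) g h →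
  weight (lex (complete m) H) F (combine g h) + ∑[ h′ < n ] label F (combine g h′)
    ≡ ∑[ g′ < m ] ∑[ h′ < n ] label F (combine g′ h′)
      + ∑[ h′ < n ] (if H h h′ then label F (combine g h′) else 0)
weight-complete-lex {m} {n} H F g h = begin
  weight K[H] F (combine g h) + row g
    ≡⟨ cong (_+ row g) (trans (weight≡∑ K[H] F _) (∑-combine m n _)) ⟩
  ∑[ g′ < m ] block g′ + row g
    ≡⟨ ∑-differAt block row g block≡row ⟩
  ∑[ g′ < m ] row g′ + block g
    ≡⟨ cong (∑[ g′ < m ] row g′ +_) (sum-cong-≗ λ h′ →
         cong (λ b → if b then label F (combine g h′) else 0) (complete-lex-≡ H g h h′)) ⟩
  ∑[ g′ < m ] row g′ + ∑[ h′ < n ] (if H h h′ then label F (combine g h′) else 0)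
    ∎
  where
  open ≡-Reasoning
  K[H] : Adj (m * n)
  K[H] = lex (complete m) H
  row block : Fin m → ℕ
  row   g′ = ∑[ h′ < n ] label F (combine g′ h′)
  block g′ = ∑[ h′ < n ] (if K[H] (combine g h) (combine g′ h′) then label F (combine g′ h′) else 0)
  block≡row : ∀ g′ → g′ ≢ g → block g′ ≡ row g′
  block≡row g′ g′≢g = sum-cong-≗ λ h′ →
    cong (λ b → if b then label F (combine g′ h′) else 0) (complete-lex-≢ H h h′ (g′≢g ∘ sym))

stack : ∀ {n} m → Labeling n → Labeling (m * n)
stack {n} m (f , f-bijective) = Bijection.to stacking , Bijection.bijective stacking
  where
  stacking : Fin (m * n) ⤖ Fin (m * n)
  stacking = ↔⇒⤖ (↔-trans (*↔× {m} {n}) (↔-trans (↔-refl ×-↔ ⤖⇒↔ (mk⤖ f-bijective)) (↔-sym *↔×)))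

stack-combine : ∀ {m n} (f : Labeling n) (g : Fin m) h →
  proj₁ (stack m f) (combine g h) ≡ combine g (proj₁ f h)
stack-combine f g h = cong (uncurry combine ∘ map₂ (proj₁ f)) (remQuot-combine g h)

label-stack : ∀ {m n} (f : Labeling n) (g : Fin m) h →
  label (stack m f) (combine g h) ≡ n * toℕ g + label f h
label-stack {m} {n} f g h = begin
  suc (toℕ (proj₁ (stack m f) (combine g h)))  ≡⟨ cong (suc ∘ toℕ) (stack-combine f g h) ⟩
  suc (toℕ (combine g (proj₁ f h)))            ≡⟨ cong suc (toℕ-combine g (proj₁ f h)) ⟩
  suc (n * toℕ g + toℕ (proj₁ f h))            ≡⟨ +-suc (n * toℕ g) _ ⟨
  n * toℕ g + label f h                        ∎
  where open ≡-Reasoning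

weight-stack : ∀ {m n} (H : Adj n) (f : Labeling n) g h →
  weight (lex (complete m) H) (stack m f) (combine g h) + (codegree H h * (n * toℕ g) + ∑[ x < n ] label f x)
    ≡ ∑[ g′ < m ] ∑[ h′ < n ] (n * toℕ g′ + label f h′) + weight H f h
weight-stack {m} {n} H f g h = +-cancelˡ-≡ (c * d) _ _ (begin
  c * d + (W + (q * c + K))
    ≡⟨ regroup W c d q K ⟩
  W + ((d + q) * c + K)
    ≡⟨ cong (λ k → W + (k * c + K)) (degree+codegree H h) ⟩
  W + (n * c + K)
    ≡⟨ cong (W +_) row-sum ⟨
  W + ∑[ h′ < n ] (c + label f h′)
    ≡⟨ cong (W +_) (sum-cong-≗ (label-stack f g)) ⟨
  W + ∑[ h′ < n ] label (stack m f) (combine g h′)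
    ≡⟨ weight-complete-lex {m} H (stack m f) g h ⟩
  ∑[ g′ < m ] ∑[ h′ < n ] label (stack m f) (combine g′ h′)
    + ∑[ h′ < n ] (if H h h′ then label (stack m f) (combine g h′) else 0)
    ≡⟨ cong₂ _+_ (sum-cong-≗ λ g′ → sum-cong-≗ (label-stack {m} f g′))
                 (sum-cong-≗ λ h′ → cong (λ ℓ → if H h h′ then ℓ else 0) (label-stack f g h′)) ⟩
  T + ∑[ h′ < n ] (if H h h′ then c + label f h′ else 0)
    ≡⟨ cong (T +_) (weight-shift H f c h) ⟩
  T + (c * d + weight H f h)
    ≡⟨ x∙yz≈y∙xz T (c * d) (weight H f h) ⟩
  c * d + (T + weight H f h)
    ∎)
  where
  open ≡-Reasoning
  W T K c d q : ℕ
  W = weight (lex (complete m) H) (stack m f) (combine g h)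
  T = ∑[ g′ < m ] ∑[ h′ < n ] (n * toℕ g′ + label f h′)
  K = ∑[ x < n ] label f x
  c = n * toℕ g
  d = degree H h
  q = codegree H h
  row-sum : ∑[ h′ < n ] (c + label f h′) ≡ n * c + K
  row-sum = trans (∑-distrib-+ (λ _ → c) (label f)) (cong (_+ K) (∑-const n c))
  regroup : ∀ w c d q k → c * d + (w + (q * c + k)) ≡ w + ((d + q) * c + k)
  regroup = solve-∀

module StackRegular {m n r : ℕ} (H : Adj n) (f : Labeling n) (regular : IsRegular H r) where

  K[H] : Adj (m * n)
  K[H] = lex (complete m) H

  W : Fin (m * n) → ℕ
  W = weight K[H] (stack m f)

  w : Fin n → ℕ
  w = weight H f

  total : ℕ
  total = ∑[ g < m ] ∑[ h < n ] (n * toℕ g + label f h)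

  offset : Fin m → ℕ
  offset g = (n ∸ r) * (n * toℕ g) + ∑[ x < n ] label f x

  weight-stack-regular : ∀ g h → W (combine g h) + offset g ≡ total + w h
  weight-stack-regular g h =
    subst (λ q → W (combine g h) + (q * (n * toℕ g) + ∑[ x < n ] label f x) ≡ total + w h)
          (codegree-regular H regular h) (weight-stack H f g h)

  W≡total+w∸offset : ∀ g h → W (combine g h) ≡ total + w h ∸ offset g
  W≡total+w∸offset g h =
    trans (sym (m+n∸n≡m _ (offset g))) (cong (_∸ offset g) (weight-stack-regular g h))

  W-collision : ∀ {g g′ h h′} → W (combine g h) ≡ W (combine g′ h′) → w h + offset g′ ≡ w h′ + offset g
  W-collision {g} {g′} {h} {h′} W≡W = +-cancelˡ-≡ total _ _ (begin
    total + (w h + offset g′)                 ≡⟨ +-assoc total _ _ ⟨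
    total + w h + offset g′                   ≡⟨ cong (_+ offset g′) (weight-stack-regular g h) ⟨
    W (combine g h) + offset g + offset g′    ≡⟨ cong (λ x → x + offset g + offset g′) W≡W ⟩
    W (combine g′ h′) + offset g + offset g′  ≡⟨ xy∙z≈xz∙y (W (combine g′ h′)) (offset g) (offset g′) ⟩
    W (combine g′ h′) + offset g′ + offset g  ≡⟨ cong (_+ offset g) (weight-stack-regular g′ h′) ⟩
    total + w h′ + offset g                   ≡⟨ +-assoc total _ _ ⟩
    total + (w h′ + offset g)                 ∎)
    where open ≡-Reasoning

  offset-step : ∀ {g g′ : Fin m} → toℕ g < toℕ g′ → offset g + n * (n ∸ r) ≤ offset g′
  offset-step {g} {g′} g<g′ = begin
    q * (n * toℕ g) + K + n * q    ≡⟨ regroup q n (toℕ g) K ⟩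
    q * (n + n * toℕ g) + K        ≡⟨ cong (λ x → q * x + K) (*-suc n (toℕ g)) ⟨
    q * (n * suc (toℕ g)) + K      ≤⟨ +-monoˡ-≤ K (*-monoʳ-≤ q (*-monoʳ-≤ n g<g′)) ⟩
    q * (n * toℕ g′) + K           ∎
    where
    open ≤-Reasoning
    q K : ℕ
    q = n ∸ r
    K = ∑[ x < n ] label f x
    regroup : ∀ q n a k → q * (n * a) + k + n * q ≡ q * (n + n * a) + k
    regroup = solve-∀

  W-separates-copies : (∀ u → H u u ≡ false) → ∀ {g g′ h h′} → toℕ g < toℕ g′ →
    W (combine g h) ≢ W (combine g′ h′)
  W-separates-copies irreflexive {g} {g′} {h} {h′} g<g′ W≡W =
    <-irrefl refl (<-≤-trans (m<m+n X 0<q) X+q≤X)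
    where
    q X : ℕ
    q = n ∸ r
    X = w h′ + offset g
    0<q : 0 < q
    0<q = subst (1 ≤_) (codegree-regular H regular h) (codegree-positive H h (irreflexive h))
    gap : w h′ + q ≤ w h + n * q
    gap = subst (λ k → w h′ + k ≤ w h + n * k) (codegree-regular H regular h)
      (weight-gap H f (trans (regular h) (sym (regular h′))))
    X+q≤X : X + q ≤ X
    X+q≤X = begin
      w h′ + offset g + q       ≡⟨ xy∙z≈xz∙y (w h′) (offset g) q ⟩
      w h′ + q + offset g       ≤⟨ +-monoˡ-≤ (offset g) gap ⟩
      w h + n * q + offset g    ≡⟨ xy∙z≈x∙zy (w h) (n * q) (offset g) ⟩
      w h + (offset g + n * q)  ≤⟨ +-monoʳ-≤ (w h) (offset-step g<g′) ⟩
      w h + offset g′           ≡⟨ W-collision W≡W ⟩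
      w h′ + offset g           ∎
      where open ≤-Reasoning

  stack-antimagic : (∀ u → H u u ≡ false) → IsLDAntimagic H f → IsLDAntimagic K[H] (stack m f)
  stack-antimagic irreflexive antimagic a b = subst₂ (λ a b → K[H] a b ≡ true → W a ≢ W b)
    (combine-remQuot {m} n a) (combine-remQuot {m} n b) (antimagic-combine _ _ _ _)
    where
    antimagic-combine : ∀ g h g′ h′ → K[H] (combine g h) (combine g′ h′) ≡ true →
      W (combine g h) ≢ W (combine g′ h′)
    antimagic-combine g h g′ h′ adjacent with <-cmpᶠ g g′
    ... | tri< g<g′ _ _ = W-separates-copies irreflexive g<g′
    ... | tri> _ _ g′<g = W-separates-copies irreflexive g′<g ∘ sym
    ... | tri≈ _ refl _ = antimagic h h′ (trans (sym (complete-lex-≡ H g h h′)) adjacent)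
                        ∘ +-cancelʳ-≡ _ _ _ ∘ W-collision

  stack-numWeights≤ : numWeights K[H] (stack m f) ≤ m * numWeights H f
  stack-numWeights≤ = distinctValues-combine≤ (λ g v → total + v ∸ offset g) W≡total+w∸offset

mainTheorem17 : (m n r : ℕ) → 0 < m → 1 < n →
    (H : Adj n) → IsSimpleGraph H → IsRegular H r →
    Σ (Labeling n) (IsLDAntimagic H) →
    (c : ℕ) → IsChiLD H c →
    ChiLD≤ (lex (complete m) H) (m * c)
mainTheorem17 m n r _ _ H (_ , irreflexive) regular _ c ((f , antimagic , f-has-c-weights) , _) =
  stack m f , stack-antimagic irreflexive antimagic ,
  subst (λ k → numWeights (lex (complete m) H) (stack m f) ≤ m * k) f-has-c-weights stack-numWeights≤
  where open StackRegular {m} H f regular
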